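{- Let $p>3$ be a prime and let $H_p=\{x:\ x\in\{0,2,3,\ldots,\frac{p-1}2\}\ \text{and}\ x^2\not\equiv -3 \pmod p\}$. Let $t\in R_p$ with $t\not\equiv 0\pmod p$. If the congruence $t\equiv \frac{(x^2+3)^3}{(x^2-1)^2}\pmod p$ is solvable for some $x\in H_p$, then $$\Big|\Big\{x\in H_p:\ \frac{(x^2+3)^3}{(x^2-1)^2}\equiv t\pmod p\Big\}\Big|=\begin{cases}3&\text{if } t\not\equiv 27\pmod p,\\ 2&\text{if } t\equiv 27\pmod p.\end{cases}$$
   Context: $R_p$ denotes the set of rational numbers whose denominators are not divisible by $p$; congruences modulo $p$ between elements of $R_p$ are understood in the usual way (i.e. in $\mathbb{Z}/p\mathbb{Z}$). -}

module Defs where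

open import Data.Nat as ℕ using (ℕ; suc; _∸_; _≤_; _≤?_; _≟_)
open import Data.Nat.Divisibility as ℕD using (_∣?_)
open import Data.Integer as ℤ using (ℤ; +_)
open import Data.Rational using (ℚ; ↥_; ↧_)
open import Data.List using (List; filter; upTo)
open import Data.Product using (_×_)
open import Relation.Nullary using (¬_; Dec)
open import Relation.Nullary.Decidable using (_×-dec_; ¬?)
open import Relation.Binary.PropositionalEquality using (_≢_)

_∣ℤ_ : ℕ → ℤ → Set
p ∣ℤ z = p ℕD.∣ ℤ.∣ z ∣

_∣ℤ?_ : (p : ℕ) (z : ℤ) → Dec (p ∣ℤ z)
p ∣ℤ? z = p ∣? ℤ.∣ z ∣

-- Congruence mod p of two elements of R_p (given as rationals): a/b ≡ c/d iff p ∣ ad - cb.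
_≡_[modℚ_] : ℚ → ℚ → ℕ → Set
r ≡ s [modℚ p ] = p ∣ℤ ((↥ r) ℤ.* (↧ s) ℤ.- (↥ s) ℤ.* (↧ r))

InRp : ℕ → ℚ → Set
InRp p t = ¬ (p ∣ℤ (↧ t))

q27 : ℚ
q27 = + 27 Data.Rational./ 1
  where import Data.Rational

sq : ℕ → ℤ
sq x = (+ x) ℤ.* (+ x)

InH : ℕ → ℕ → Set
InH p x = (x ≤ (p ∸ 1) ℕ./ 2) × (x ≢ 1) × ¬ (p ∣ℤ (sq x ℤ.+ + 3))

InH? : (p x : ℕ) → Dec (InH p x)
InH? p x = (x ≤? (p ∸ 1) ℕ./ 2) ×-dec (¬? (x ≟ 1)) ×-dec (¬? (p ∣ℤ? (sq x ℤ.+ + 3)))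

Hp : ℕ → List ℕ
Hp p = filter (InH? p) (upTo (suc ((p ∸ 1) ℕ./ 2)))

-- (x²+3)³/(x²-1)² ≡ t (mod p), for t = a/b in lowest terms:
-- cross-multiplied, p ∣ (x²+3)³·b − a·(x²−1)²  (x²−1 is invertible mod p for x ∈ H_p).
solExpr : ℚ → ℕ → ℤ
solExpr t x = u ℤ.* u ℤ.* u ℤ.* (↧ t) ℤ.- (↥ t) ℤ.* v ℤ.* v
  where
  u = sq x ℤ.+ + 3
  v = sq x ℤ.- + 1

SolCong : ℕ → ℚ → ℕ → Set
SolCong p t x = p ∣ℤ solExpr t x

SolCong? : (p : ℕ) (t : ℚ) (x : ℕ) → Dec (SolCong p t x)
SolCong? p t x = p ∣ℤ? solExpr t x

Sols : ℕ → ℚ → List ℕ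
Sols p t = filter (SolCong? p t) (Hp p)

-- Write f(y) = (y² + 3)³ / (y² − 1)².  The numerator of f(y) − f(x) factors as
--   (y² − x²) · ((1 − x)² y² − (x + 3)²) · ((1 + x)² y² − (x − 3)²),
-- so f(y) ≡ f(x) (mod p) exactly when y² is congruent to x², σ(x)² or σ(−x)², where
-- σ(x) = (x + 3)/(1 − x).  Every square class has exactly one root in {0, …, (p − 1)/2},
-- and that root lies in H_p as soon as the class is neither 1 nor −3; so the solution
-- count is the number of distinct classes among x², σ(x)², σ(−x)².  For x ∈ H_p they are
-- distinct unless x ≡ 0 or x² ≡ 9, which is precisely the case t ≡ 27, because
-- f(y) − 27 = y² (y² − 9)² / (y² − 1)²; then the solutions are the roots of the classes 0 and 9.
module Submission where

open import Data.Nat as ℕ using (ℕ; zero; suc; z≤n; s≤s; _<_; _≤_)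
import Data.Nat.Properties as ℕ
import Data.Nat.Divisibility as ℕ
import Data.Nat.DivMod as ℕ
import Data.Nat.Primality as ℕ
import Data.Nat.Tactic.RingSolver as ℕ
open import Data.Nat.Primality using (Prime)
open import Data.Nat.Coprimality using (Coprime; coprime-Bézout)
open import Data.Nat.GCD using (module Bézout)
open import Data.Integer as ℤ using (ℤ; +_; -[1+_]; _+_; _*_; _-_; -_)
import Data.Integer.Properties as ℤ
open import Data.Integer.Divisibility.Signed
open import Data.Integer.DivMod using (_%ℕ_; _/ℕ_; n%ℕd<d; a≡a%ℕn+[a/ℕn]*n)
open import Data.Integer.Tactic.RingSolver using (solve-∀)
open import Data.Rational using (ℚ; ↥_; ↧_; 0ℚ)
open import Data.List using (List; []; _∷_; map; filter; length; upTo)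
open import Data.List.Properties using (length-map)
open import Data.List.Membership.Propositional using (_∈_)
open import Data.List.Membership.Propositional.Properties using (∈-filter⁺; ∈-filter⁻; ∈-upTo⁺; ∈-map⁻)
open import Data.List.Membership.Propositional.Properties.WithK using (unique∧set⇒bag)
open import Data.List.Relation.Binary.BagAndSetEquality using (∼bag⇒↭)
open import Data.List.Relation.Binary.Permutation.Propositional.Properties using (↭-length)
open import Data.List.Relation.Unary.All as All using (All; []; _∷_)
open import Data.List.Relation.Unary.AllPairs as AllPairs using (AllPairs; []; _∷_)
import Data.List.Relation.Unary.AllPairs.Properties as AllPairs
open import Data.List.Relation.Unary.Any as Any using (Any; here; there)
import Data.List.Relation.Unary.Any.Properties as Any
open import Data.List.Relation.Unary.Unique.Propositional using (Unique)
import Data.List.Relation.Unary.Unique.Propositional.Properties as Unique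
open import Data.Product using (∃; ∃-syntax; _×_; _,_; proj₁; proj₂)
open import Data.Sum using (_⊎_; inj₁; inj₂; [_,_]′)
open import Data.Empty using (⊥-elim)
open import Function using (_∘_)
open import Function.Bundles using (_⇔_; mk⇔; Equivalence)
open import Function.Construct.Composition using (_⇔-∘_)
open import Relation.Nullary using (¬_; yes; no)
open import Relation.Unary using (Pred; Decidable)
open import Relation.Binary.PropositionalEquality

open import Defs

length-filter-unique : ∀ {a ℓ} {A : Set a} {P : Pred A ℓ} (P? : Decidable P) {xs ys : List A} →
  Unique xs → Unique ys → (∀ {y} → (y ∈ xs × P y) ⇔ y ∈ ys) →
  length (filter P? xs) ≡ length ys
length-filter-unique P? {xs} xs! ys! same =
  ↭-length (∼bag⇒↭ (unique∧set⇒bag (Unique.filter⁺ P? xs!) ys! (mk⇔ to from)))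
  where
  to : ∀ {y} → y ∈ filter P? xs → y ∈ _
  to y∈ = Equivalence.to same (∈-filter⁻ P? y∈)
  from : ∀ {y} → y ∈ _ → y ∈ filter P? xs
  from y∈ = let (y∈xs , Py) = Equivalence.from same y∈ in ∈-filter⁺ P? y∈xs Py

module ModPrime {p : ℕ} (p-prime : Prime p) where

  euclidsLemma : ∀ a b → + p ∣ a * b → + p ∣ a ⊎ + p ∣ b
  euclidsLemma a b p∣ab
    with ℕ.euclidsLemma ℤ.∣ a ∣ ℤ.∣ b ∣ p-prime (subst (p ℕ.∣_) (ℤ.abs-* a b) (∣⇒∣ᵤ p∣ab))
  ... | inj₁ p∣a = inj₁ (∣ᵤ⇒∣ p∣a)
  ... | inj₂ p∣b = inj₂ (∣ᵤ⇒∣ p∣b)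

  euclidsLemma₃ : ∀ a b c → + p ∣ a * b * c → + p ∣ a ⊎ + p ∣ b ⊎ + p ∣ c
  euclidsLemma₃ a b c p∣abc with euclidsLemma (a * b) c p∣abc
  ... | inj₂ p∣c = inj₂ (inj₂ p∣c)
  ... | inj₁ p∣ab with euclidsLemma a b p∣ab
  ...   | inj₁ p∣a = inj₁ p∣a
  ...   | inj₂ p∣b = inj₂ (inj₁ p∣b)

  ∤-* : ∀ {a b} → ¬ + p ∣ a → ¬ + p ∣ b → ¬ + p ∣ a * b
  ∤-* p∤a p∤b p∣ab = [ p∤a , p∤b ]′ (euclidsLemma _ _ p∣ab)

  ∣-cancelˡ : ∀ {c a} → ¬ + p ∣ c → + p ∣ c * a → + p ∣ a
  ∣-cancelˡ {c} {a} p∤c p∣ca = [ ⊥-elim ∘ p∤c , (λ p∣a → p∣a) ]′ (euclidsLemma c a p∣ca)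

  ∤-neg : ∀ {a} → ¬ + p ∣ a → ¬ + p ∣ - a
  ∤-neg {a} p∤a p∣-a = p∤a (subst (+ p ∣_) (ℤ.neg-involutive a) (∣m⇒∣-m p∣-a))

  ∤-≡ : ∀ {a b} → a ≡ b → ¬ + p ∣ a → ¬ + p ∣ b
  ∤-≡ refl p∤a = p∤a

  ∣-multiple : ∀ {a b} u → a ≡ u * b → + p ∣ b → + p ∣ a
  ∣-multiple u refl p∣b = ∣n⇒∣m*n u p∣b

  ∣-linear : ∀ {a b c} u v → a ≡ u * b + v * c → + p ∣ b → + p ∣ c → + p ∣ a
  ∣-linear u v refl p∣b p∣c = ∣m∣n⇒∣m+n (∣n⇒∣m*n u p∣b) (∣n⇒∣m*n v p∣c)

  ∤-pos : ∀ {n} → 0 < n → n < p → ¬ + p ∣ + n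
  ∤-pos 0<n n<p p∣n = ℕ.<⇒≱ n<p (ℕ.∣⇒≤ ⦃ ℕ.>-nonZero 0<n ⦄ (∣⇒∣ᵤ p∣n))

  ∣-pos⇒≡0 : ∀ {n} → n < p → + p ∣ + n → n ≡ 0
  ∣-pos⇒≡0 {zero}  _   _   = refl
  ∣-pos⇒≡0 {suc n} n<p p∣n = ⊥-elim (∤-pos (s≤s z≤n) n<p p∣n)

  private
    pos-equation : ∀ a b c d e → a ℕ.+ b ℕ.* c ≡ d ℕ.* e → + a + + b * + c ≡ + d * + e
    pos-equation a b c d e eq = begin
      + a + + b * + c   ≡⟨ cong (λ e → + a + e) (ℤ.pos-* b c) ⟨
      + a + + (b ℕ.* c) ≡⟨ ℤ.pos-+ a (b ℕ.* c) ⟨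
      + (a ℕ.+ b ℕ.* c) ≡⟨ cong +_ eq ⟩
      + (d ℕ.* e)       ≡⟨ ℤ.pos-* d e ⟩
      + d * + e         ∎
      where open ≡-Reasoning

  ∃-inverse : ∀ {c} → ¬ + p ∣ c → ∃ λ w → + p ∣ c * w - + 1
  ∃-inverse {+ n} p∤n with coprime-Bézout p⊥n
    where
    p⊥n : Coprime p n
    p⊥n (d∣p , d∣n) with ℕ.prime⇒irreducible p-prime d∣p
    ... | inj₁ d≡1  = d≡1
    ... | inj₂ refl = ⊥-elim (p∤n (∣ᵤ⇒∣ d∣n))
  ... | Bézout.+- x y eq = - + y , divides (- + x) (begin
      + n * - + y - + 1   ≡⟨ identity (+ n) (+ y) ⟩
      - (+ 1 + + y * + n) ≡⟨ cong -_ (pos-equation 1 y n x p eq) ⟩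
      - (+ x * + p)       ≡⟨ ℤ.neg-distribˡ-* (+ x) (+ p) ⟩
      - + x * + p         ∎)
    where
    open ≡-Reasoning
    identity : ∀ n y → n * - y - + 1 ≡ - (+ 1 + y * n)
    identity = solve-∀
  ... | Bézout.-+ x y eq = + y , divides (+ x) (begin
      + n * + y - + 1       ≡⟨ cong (_- + 1) (ℤ.*-comm (+ n) (+ y)) ⟩
      + y * + n - + 1       ≡⟨ cong (_- + 1) (pos-equation 1 x p y n eq) ⟨
      + 1 + + x * + p - + 1 ≡⟨ identity (+ x * + p) ⟩
      + x * + p             ∎)
    where
    open ≡-Reasoning
    identity : ∀ e → + 1 + e - + 1 ≡ e
    identity = solve-∀
  ∃-inverse { -[1+ n ]} p∤c with ∃-inverse {+ suc n} (p∤c ∘ ∣m⇒∣-m)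
  ... | w , p∣nw-1 = - w , subst (+ p ∣_) (identity (+ suc n) w) p∣nw-1
    where
    identity : ∀ m w → m * w - + 1 ≡ (- m) * (- w) - + 1
    identity = solve-∀

  infix 4 _≈_
  _≈_ : ℤ → ℤ → Set
  a ≈ b = + p ∣ a - b

  ≈-refl : ∀ {a} → a ≈ a
  ≈-refl {a} = divides (+ 0) (ℤ.+-inverseʳ a)

  ≈-sym : ∀ {a b} → a ≈ b → b ≈ a
  ≈-sym {a} {b} = ∣-multiple (- + 1) (identity a b)
    where
    identity : ∀ a b → b - a ≡ - + 1 * (a - b)
    identity = solve-∀

  ≈-trans : ∀ {a b c} → a ≈ b → b ≈ c → a ≈ c
  ≈-trans {a} {b} {c} = ∣-linear (+ 1) (+ 1) (identity a b c)
    where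
    identity : ∀ a b c → a - c ≡ + 1 * (a - b) + + 1 * (b - c)
    identity = solve-∀

  ≈-pos⇒∸≡0 : ∀ {m n} → m < p → n ≤ m → + m ≈ + n → m ℕ.∸ n ≡ 0
  ≈-pos⇒∸≡0 {m} {n} m<p n≤m m≈n = ∣-pos⇒≡0 (ℕ.≤-<-trans (ℕ.m∸n≤m m n) m<p)
    (subst (+ p ∣_) (trans (ℤ.m-n≡m⊖n m n) (ℤ.⊖-≥ n≤m)) m≈n)

  ≈-pos⇒≡ : ∀ {m n} → m < p → n < p → + m ≈ + n → m ≡ n
  ≈-pos⇒≡ {m} {n} m<p n<p m≈n with ℕ.≤-total m n
  ... | inj₁ m≤n =
    ℕ.≤-antisym m≤n (ℕ.m∸n≡0⇒m≤n (≈-pos⇒∸≡0 n<p m≤n (≈-sym {+ m} {+ n} m≈n)))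
  ... | inj₂ n≤m =
    ℕ.≤-antisym (ℕ.m∸n≡0⇒m≤n (≈-pos⇒∸≡0 m<p n≤m m≈n)) n≤m

  ∃-quotient : ∀ {c} → ¬ + p ∣ c → ∀ d → ∃ λ z → c * z ≈ d
  ∃-quotient {c} p∤c d with ∃-inverse p∤c
  ... | w , p∣cw-1 = w * d , ∣-multiple d (identity c w d) p∣cw-1
    where
    identity : ∀ c w d → c * (w * d) - d ≡ d * (c * w - + 1)
    identity = solve-∀

  square-quotient : ∀ {c d z} → ¬ + p ∣ c → c * z ≈ d → ∀ w → w ≈ z * z ⇔ c * c * w ≈ d * d
  square-quotient {c} {d} {z} p∤c cz≈d w = mk⇔
    (λ w≈zz → ∣-linear (c * c) (c * z + d) (expand c d z w) w≈zz cz≈d)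
    (λ ccw≈dd → ∣-cancelˡ (∤-* p∤c p∤c)
      (∣-linear (+ 1) (- (c * z + d)) (contract c d z w) ccw≈dd cz≈d))
    where
    expand : ∀ c d z w → c * c * w - d * d ≡ c * c * (w - z * z) + (c * z + d) * (c * z - d)
    expand = solve-∀
    contract : ∀ c d z w →
      c * c * (w - z * z) ≡ + 1 * (c * c * w - d * d) + - (c * z + d) * (c * z - d)
    contract = solve-∀

module HalfRange {p : ℕ} (p-prime : Prime p) (2<p : 2 < p) where

  open ModPrime p-prime

  half : ℕ
  half = (p ℕ.∸ 1) ℕ./ 2

  private instance
    p-nonZero : ℕ.NonZero p
    p-nonZero = ℕ.prime⇒nonZero p-prime

  p≡1+2half : p ≡ suc (half ℕ.+ half)
  p≡1+2half with (p ℕ.∸ 1) ℕ.% 2 | ℕ.m%n<n (p ℕ.∸ 1) 2 | ℕ.m≡m%n+[m/n]*n (p ℕ.∸ 1) 2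
  ... | 0 | _ | p-1≡2half = begin
    p                   ≡⟨ ℕ.suc-pred p ⟨
    suc (p ℕ.∸ 1)       ≡⟨ cong suc p-1≡2half ⟩
    suc (half ℕ.* 2)    ≡⟨ cong suc (double half) ⟩
    suc (half ℕ.+ half) ∎
    where
    open ≡-Reasoning
    double : ∀ n → n ℕ.* 2 ≡ n ℕ.+ n
    double = ℕ.solve-∀
  ... | 1 | _ | p-1≡1+2half =
    ⊥-elim (2∤p (ℕ.divides (suc half) (trans (sym (ℕ.suc-pred p)) (cong suc p-1≡1+2half))))
    where
    2∤p : ¬ 2 ℕ.∣ p
    2∤p 2∣p with ℕ.prime⇒irreducible p-prime 2∣p
    ... | inj₂ 2≡p = ℕ.<-irrefl 2≡p 2<p
  ... | suc (suc _) | s≤s (s≤s ()) | _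

  half+half<p : half ℕ.+ half < p
  half+half<p = subst (half ℕ.+ half <_) (sym p≡1+2half) ℕ.≤-refl

  half<p : half < p
  half<p = ℕ.≤-<-trans (ℕ.m≤m+n half half) half+half<p

  1+half<p : suc half < p
  1+half<p = subst (suc half <_) (sym p≡1+2half)
    (s≤s (subst (ℕ._≤ half ℕ.+ half) (ℕ.+-comm half 1) (ℕ.+-monoʳ-≤ half 0<half)))
    where
    0<half : 0 < half
    0<half with half | p≡1+2half
    ... | suc _ | _   = s≤s z≤n
    ... | zero  | p≡1 = ⊥-elim (ℕ.<-irrefl (sym p≡1) (ℕ.<-trans (ℕ.n<1+n 1) 2<p))

  root-unique : ∀ {r r′} → r ≤ half → r′ ≤ half → + r * + r ≈ + r′ * + r′ → r ≡ r′
  root-unique {r} {r′} r≤half r′≤half rr≈r′r′ =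
    [ ≈-pos⇒≡ (ℕ.≤-<-trans r≤half half<p) (ℕ.≤-<-trans r′≤half half<p) , both-zero ]′
      (euclidsLemma (+ r - + r′) (+ r + + r′) (∣-multiple (+ 1) (factor (+ r) (+ r′)) rr≈r′r′))
    where
    factor : ∀ a b → (a - b) * (a + b) ≡ + 1 * (a * a - b * b)
    factor = solve-∀
    both-zero : + p ∣ + r + + r′ → r ≡ r′
    both-zero p∣r+r′ = trans (ℕ.m+n≡0⇒m≡0 r r+r′≡0) (sym (ℕ.m+n≡0⇒n≡0 r r+r′≡0))
      where
      r+r′≡0 : r ℕ.+ r′ ≡ 0
      r+r′≡0 = ∣-pos⇒≡0 (ℕ.≤-<-trans (ℕ.+-mono-≤ r≤half r′≤half) half+half<p) p∣r+r′

  ∃-root-of-residue : ∀ {z m} → m < p → z ≈ + m → ∃ λ r → r ≤ half × + r * + r ≈ z * z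
  ∃-root-of-residue {z} {m} m<p z≈m with m ℕ.≤? half
  ... | yes m≤half = m , m≤half , ∣-multiple (- (+ m + z)) (factor (+ m) z) z≈m
    where
    factor : ∀ m z → m * m - z * z ≡ - (m + z) * (z - m)
    factor = solve-∀
  ... | no m≰half = p ℕ.∸ m , p-m≤half , subst (λ r → + p ∣ r * r - z * z) (sym p-m≡p-m)
      (∣-linear (+ p - + m - z) (+ p - + m - z) (factor (+ p) (+ m) z) ∣-refl z≈m)
    where
    p-m≤half : p ℕ.∸ m ≤ half
    p-m≤half = ℕ.≤-trans (ℕ.∸-monoʳ-≤ p (ℕ.≰⇒> m≰half))
      (ℕ.≤-reflexive (trans (cong (ℕ._∸ suc half) p≡1+2half) (ℕ.m+n∸n≡m half half)))
    p-m≡p-m : + (p ℕ.∸ m) ≡ + p - + m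
    p-m≡p-m = sym (trans (ℤ.m-n≡m⊖n p m) (ℤ.⊖-≥ (ℕ.<⇒≤ m<p)))
    factor : ∀ p m z → (p - m) * (p - m) - z * z ≡ (p - m - z) * p + (p - m - z) * (z - m)
    factor = solve-∀

  root-exists : ∀ z → ∃ λ r → r ≤ half × + r * + r ≈ z * z
  root-exists z = ∃-root-of-residue {z} (n%ℕd<d z p)
    (divides (z /ℕ p) (residue (a≡a%ℕn+[a/ℕn]*n z p)))
    where
    residue : z ≡ + (z %ℕ p) + z /ℕ p * + p → z - + (z %ℕ p) ≡ z /ℕ p * + p
    residue eq = trans (cong (_- + (z %ℕ p)) eq) (cancel (+ (z %ℕ p)) (z /ℕ p * + p))
      where
      cancel : ∀ m e → m + e - m ≡ e
      cancel = solve-∀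

  root : ℤ → ℕ
  root z = proj₁ (root-exists z)

  root≤half : ∀ z → root z ≤ half
  root≤half z = proj₁ (proj₂ (root-exists z))

  root-square : ∀ z → + root z * + root z ≈ z * z
  root-square z = proj₂ (proj₂ (root-exists z))

  ∈Hp⇒InH : ∀ {x} → x ∈ Hp p → InH p x
  ∈Hp⇒InH = proj₂ ∘ ∈-filter⁻ (InH? p) {xs = upTo (suc half)}

  InH⇒∈Hp : ∀ {x} → InH p x → x ∈ Hp p
  InH⇒∈Hp x∈H = ∈-filter⁺ (InH? p) (∈-upTo⁺ (s≤s (proj₁ x∈H))) x∈H

  Hp-unique : Unique (Hp p)
  Hp-unique = Unique.filter⁺ (InH? p) (Unique.upTo⁺ (suc half))

  ∈Hp⇒units : ∀ {x} → x ∈ Hp p →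
              ¬ + p ∣ + 1 - + x × ¬ + p ∣ + 1 + + x × ¬ + p ∣ + x * + x + + 3
  ∈Hp⇒units {x} x∈Hp with ∈Hp⇒InH x∈Hp
  ... | x≤half , x≢1 , x²+3≢0 = p∤1-x x x≤half x≢1 , p∤1+x , x²+3≢0 ∘ ∣⇒∣ᵤ
    where
    p∤1+x : ¬ + p ∣ + 1 + + x
    p∤1+x = ∤-pos (s≤s z≤n) (ℕ.≤-<-trans (s≤s x≤half) 1+half<p)
    p∤1-x : ∀ x → x ≤ half → x ≢ 1 → ¬ + p ∣ + 1 - + x
    p∤1-x zero          _      _   = ∤-pos (s≤s z≤n) (ℕ.≤-<-trans (s≤s z≤n) 1+half<p)
    p∤1-x (suc zero)    _      x≢1 = ⊥-elim (x≢1 refl)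
    p∤1-x (suc (suc k)) x≤half _   =
      ∤-neg (∤-pos (s≤s z≤n) (ℕ.<-trans (ℕ.n<1+n (suc k)) (ℕ.≤-<-trans x≤half half<p)))

  root∈Hp : ∀ {z} → ¬ + 1 ≈ z * z → ¬ - + 3 ≈ z * z → root z ∈ Hp p
  root∈Hp {z} 1≉zz -3≉zz = InH⇒∈Hp (root≤half z , root≢1 , -3≉zz ∘ -3≈zz ∘ ∣ᵤ⇒∣)
    where
    root≢1 : root z ≢ 1
    root≢1 r≡1 = 1≉zz (subst (λ r → + r * + r ≈ z * z) r≡1 (root-square z))
    -3≈zz : + p ∣ + root z * + root z + + 3 → - + 3 ≈ z * z
    -3≈zz = ∣-linear (+ 1) (- + 1) (identity (+ root z) z) (root-square z)
      where
      identity : ∀ r z → - + 3 - z * z ≡ + 1 * (r * r - z * z) + - + 1 * (r * r + + 3)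
      identity = solve-∀

  length-filter-Hp : ∀ {ℓ} {P : Pred ℕ ℓ} (P? : Decidable P) (zs : List ℤ) →
    AllPairs (λ z z′ → ¬ z * z ≈ z′ * z′) zs →
    All (λ z → ¬ + 1 ≈ z * z × ¬ - + 3 ≈ z * z) zs →
    (∀ {y} → y ∈ Hp p → P y ⇔ Any (λ z → + y * + y ≈ z * z) zs) →
    length (filter P? (Hp p)) ≡ length zs
  length-filter-Hp {P = P} P? zs zs-distinct zs-admissible P⇔ = begin
    length (filter P? (Hp p)) ≡⟨ length-filter-unique P? Hp-unique roots-unique (mk⇔ to from) ⟩
    length (map root zs)      ≡⟨ length-map root zs ⟩
    length zs                 ∎
    where
    open ≡-Reasoning
    distinct : ∀ {z z′} → ¬ z * z ≈ z′ * z′ → root z ≢ root z′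
    distinct {z} {z′} zz≉z′z′ r≡r′ = zz≉z′z′
      (≈-trans {z * z} (≈-sym {+ root z * + root z} (root-square z))
        (subst (λ r → + r * + r ≈ z′ * z′) (sym r≡r′) (root-square z′)))
    roots-unique : Unique (map root zs)
    roots-unique = AllPairs.map⁺ (AllPairs.map (λ {z} {z′} → distinct {z} {z′}) zs-distinct)
    to : ∀ {y} → y ∈ Hp p × P y → y ∈ map root zs
    to {y} (y∈Hp , Py) = Any.map⁺ (Any.map (λ {z} → y≡root {z}) (Equivalence.to (P⇔ y∈Hp) Py))
      where
      y≡root : ∀ {z} → + y * + y ≈ z * z → y ≡ root z
      y≡root {z} yy≈zz = root-unique (proj₁ (∈Hp⇒InH y∈Hp)) (root≤half z)
        (≈-trans {+ y * + y} yy≈zz (≈-sym {+ root z * + root z} (root-square z)))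
    root-solution : ∀ {z} → z ∈ zs → root z ∈ Hp p × P (root z)
    root-solution {z} z∈zs =
      r∈Hp , Equivalence.from (P⇔ r∈Hp) (Any.map (λ { refl → root-square z }) z∈zs)
      where
      admissible = All.lookup zs-admissible z∈zs
      r∈Hp = root∈Hp {z} (proj₁ admissible) (proj₂ admissible)
    from : ∀ {y} → y ∈ map root zs → y ∈ Hp p × P y
    from y∈roots = let (z , z∈zs , y≡root) = ∈-map⁻ root y∈roots in
      subst (λ y → y ∈ Hp p × P y) (sym y≡root) (root-solution z∈zs)

-- With w = y², Φ A B w ≡ 0 (mod p) is f(y) ≡ A/B cleared of denominators;
-- Defs.solExpr t y is Φ (↥ t) (↧ t) (y²) on the nose.
U V : ℤ → ℤ
U w = w + + 3
V w = w - + 1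

Φ : ℤ → ℤ → ℤ → ℤ
Φ A B w = U w * U w * U w * B - A * V w * V w

Δ : ℤ → ℤ → ℤ
Δ w v = U v * U v * U v * (V w * V w) - U w * U w * U w * (V v * V v)

-- σ-gap x w = (1 − x)² (w − σ(x)²) for σ(x) = (x + 3)/(1 − x).
σ-num σ-den : ℤ → ℤ
σ-num x = x + + 3
σ-den x = + 1 - x

σ-gap : ℤ → ℤ → ℤ
σ-gap x w = σ-den x * σ-den x * w - σ-num x * σ-num x

Ψ : ℤ → ℤ
Ψ w = w * (w - + 9) * (w - + 9)

Φ-difference : ∀ A B w v → V w * V w * Φ A B v ≡ B * Δ w v + V v * V v * Φ A B w
Φ-difference A B w v = identity A B (U w) (V w) (U v) (V v)
  where
  identity : ∀ A B uw vw uv vv →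
    vw * vw * (uv * uv * uv * B - A * vv * vv)
      ≡ B * (uv * uv * uv * (vw * vw) - uw * uw * uw * (vv * vv))
        + vv * vv * (uw * uw * uw * B - A * vw * vw)
  identity = solve-∀

Δ-factorisation : ∀ x w → Δ (x * x) w ≡ (w - x * x) * σ-gap x w * σ-gap (- x) w
Δ-factorisation = factorisation
  where
  factorisation : ∀ x w →
    (w + + 3) * (w + + 3) * (w + + 3) * ((x * x - + 1) * (x * x - + 1))
      - (x * x + + 3) * (x * x + + 3) * (x * x + + 3) * ((w - + 1) * (w - + 1))
    ≡ (w - x * x) * ((+ 1 - x) * (+ 1 - x) * w - (x + + 3) * (x + + 3))
                  * ((+ 1 - - x) * (+ 1 - - x) * w - (- x + + 3) * (- x + + 3))
  factorisation = solve-∀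

Φ-at-27 : ∀ A B w → Φ A B w ≡ B * Ψ w + V w * V w * (+ 27 * B - A)
Φ-at-27 = identity
  where
  identity : ∀ A B w →
    (w + + 3) * (w + + 3) * (w + + 3) * B - A * (w - + 1) * (w - + 1)
      ≡ B * (w * (w - + 9) * (w - + 9)) + (w - + 1) * (w - + 1) * (+ 27 * B - A)
  identity = solve-∀

module Orbit {p : ℕ} (p-prime : Prime p) (3<p : 3 < p) where

  open ModPrime p-prime

  p∤1 : ¬ + p ∣ + 1
  p∤1 = ∤-pos (s≤s z≤n) (ℕ.<-trans (ℕ.n<1+n 1) (ℕ.<-trans (ℕ.n<1+n 2) 3<p))

  p∤2 : ¬ + p ∣ + 2
  p∤2 = ∤-pos (s≤s z≤n) (ℕ.<-trans (ℕ.n<1+n 2) 3<p)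

  p∤3 : ¬ + p ∣ + 3
  p∤3 = ∤-pos (s≤s z≤n) 3<p

  p∤4 : ¬ + p ∣ + 4
  p∤4 = ∤-* p∤2 p∤2

  record NonDegenerate (x : ℤ) : Set where
    field
      p∤x    : ¬ + p ∣ x
      p∤1-x  : ¬ + p ∣ + 1 - x
      p∤1+x  : ¬ + p ∣ + 1 + x
      p∤x-3  : ¬ + p ∣ x - + 3
      p∤x+3  : ¬ + p ∣ x + + 3
      p∤x²+3 : ¬ + p ∣ x * x + + 3

  square-neg : ∀ x → x * x ≡ - x * - x
  square-neg = solve-∀

  NonDegenerate-neg : ∀ {x} → NonDegenerate x → NonDegenerate (- x)
  NonDegenerate-neg {x} nd = record
    { p∤x    = ∤-neg p∤x
    ; p∤1-x  = ∤-≡ (cong (λ e → + 1 + e) (sym (ℤ.neg-involutive x))) p∤1+x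
    ; p∤1+x  = p∤1-x
    ; p∤x-3  = ∤-≡ (ℤ.neg-distrib-+ x (+ 3)) (∤-neg p∤x+3)
    ; p∤x+3  = ∤-≡ (identity x) (∤-neg p∤x-3)
    ; p∤x²+3 = ∤-≡ (cong (_+ + 3) (square-neg x)) p∤x²+3
    }
    where
    open NonDegenerate nd
    identity : ∀ x → - (x - + 3) ≡ - x + + 3
    identity = solve-∀

  module _ {x : ℤ} (nd : NonDegenerate x) where

    open NonDegenerate nd

    σ-root : ℤ
    σ-root = proj₁ (∃-quotient p∤1-x (σ-num x))

    σ-root-class : ∀ w → w ≈ σ-root * σ-root ⇔ + p ∣ σ-gap x w
    σ-root-class = square-quotient p∤1-x (proj₂ (∃-quotient p∤1-x (σ-num x)))

    σ-root≉1 : ¬ + 1 ≈ σ-root * σ-root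
    σ-root≉1 = ∤-* (∤-neg (∤-* p∤2 p∤4)) p∤1+x ∘ subst (+ p ∣_) (identity x)
             ∘ Equivalence.to (σ-root-class (+ 1))
      where
      identity : ∀ x →
        (+ 1 - x) * (+ 1 - x) * + 1 - (x + + 3) * (x + + 3) ≡ - (+ 2 * + 4) * (+ 1 + x)
      identity = solve-∀

    σ-root≉-3 : ¬ - + 3 ≈ σ-root * σ-root
    σ-root≉-3 = ∤-* (∤-neg p∤4) p∤x²+3 ∘ subst (+ p ∣_) (identity x)
              ∘ Equivalence.to (σ-root-class (- + 3))
      where
      identity : ∀ x →
        (+ 1 - x) * (+ 1 - x) * - + 3 - (x + + 3) * (x + + 3) ≡ - + 4 * (x * x + + 3)
      identity = solve-∀

    σ-root≉x : ¬ x * x ≈ σ-root * σ-root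
    σ-root≉x = ∤-* p∤x²+3 (∤-* p∤x-3 p∤1+x) ∘ subst (+ p ∣_) (identity x)
             ∘ Equivalence.to (σ-root-class (x * x))
      where
      identity : ∀ x → (+ 1 - x) * (+ 1 - x) * (x * x) - (x + + 3) * (x + + 3)
                     ≡ (x * x + + 3) * ((x - + 3) * (+ 1 + x))
      identity = solve-∀

  σ-gaps-coprime : ∀ {x w} → NonDegenerate x → + p ∣ σ-gap x w → ¬ + p ∣ σ-gap (- x) w
  σ-gaps-coprime {x} {w} nd p∣σx = ∤-* (∤-* (∤-neg (∤-* p∤4 p∤4)) p∤x) p∤x²+3
    ∘ ∣-linear (σ-den (- x) * σ-den (- x)) (- (σ-den x * σ-den x)) (identity x w) p∣σx
    where
    open NonDegenerate nd
    identity : ∀ x w → - (+ 4 * + 4) * x * (x * x + + 3)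
      ≡ (+ 1 - - x) * (+ 1 - - x) * ((+ 1 - x) * (+ 1 - x) * w - (x + + 3) * (x + + 3))
        + - ((+ 1 - x) * (+ 1 - x)) * ((+ 1 - - x) * (+ 1 - - x) * w - (- x + + 3) * (- x + + 3))
    identity = solve-∀

  module _ {x : ℤ} (nd : NonDegenerate x) where

    open NonDegenerate nd

    private
      nd₋ = NonDegenerate-neg nd

    orbit : List ℤ
    orbit = x ∷ σ-root nd ∷ σ-root nd₋ ∷ []

    orbit-classes : ∀ w → + p ∣ Δ (x * x) w ⇔ Any (λ z → w ≈ z * z) orbit
    orbit-classes w = mk⇔ (classify ∘ factors) (subst (+ p ∣_) (sym (Δ-factorisation x w)) ∘ product)
      where
      factors : + p ∣ Δ (x * x) w → w ≈ x * x ⊎ + p ∣ σ-gap x w ⊎ + p ∣ σ-gap (- x) w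
      factors = euclidsLemma₃ (w - x * x) (σ-gap x w) (σ-gap (- x) w)
              ∘ subst (+ p ∣_) (Δ-factorisation x w)
      classify : w ≈ x * x ⊎ + p ∣ σ-gap x w ⊎ + p ∣ σ-gap (- x) w →
                 Any (λ z → w ≈ z * z) orbit
      classify (inj₁ w≈xx)         = here w≈xx
      classify (inj₂ (inj₁ p∣σx))  = there (here (Equivalence.from (σ-root-class nd w) p∣σx))
      classify (inj₂ (inj₂ p∣σ-x)) = there (there (here (Equivalence.from (σ-root-class nd₋ w) p∣σ-x)))
      product : Any (λ z → w ≈ z * z) orbit → + p ∣ (w - x * x) * σ-gap x w * σ-gap (- x) w
      product (here w≈xx) =
        ∣m⇒∣m*n (σ-gap (- x) w) (∣m⇒∣m*n (σ-gap x w) w≈xx)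
      product (there (here w≈σσ)) =
        ∣m⇒∣m*n (σ-gap (- x) w) (∣n⇒∣m*n (w - x * x) (Equivalence.to (σ-root-class nd w) w≈σσ))
      product (there (there (here w≈σσ))) =
        ∣n⇒∣m*n ((w - x * x) * σ-gap x w) (Equivalence.to (σ-root-class nd₋ w) w≈σσ)

    orbit-distinct : AllPairs (λ z z′ → ¬ z * z ≈ z′ * z′) orbit
    orbit-distinct = (σ-root≉x nd ∷ x²≉σ₋² ∷ []) ∷ (σ²≉σ₋² ∷ []) ∷ [] ∷ []
      where
      σ₋σ₋ = σ-root nd₋ * σ-root nd₋
      σσ = σ-root nd * σ-root nd
      x²≉σ₋² : ¬ x * x ≈ σ₋σ₋
      x²≉σ₋² = subst (λ u → ¬ u ≈ σ₋σ₋) (sym (square-neg x)) (σ-root≉x nd₋)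
      σ²≉σ₋² : ¬ σσ ≈ σ₋σ₋
      σ²≉σ₋² = σ-gaps-coprime nd (Equivalence.to (σ-root-class nd σσ) (≈-refl {σσ}))
             ∘ Equivalence.to (σ-root-class nd₋ σσ)

    orbit-admissible : All (λ z → ¬ + 1 ≈ z * z × ¬ - + 3 ≈ z * z) orbit
    orbit-admissible =
      (1≉xx , -3≉xx) ∷ (σ-root≉1 nd , σ-root≉-3 nd) ∷ (σ-root≉1 nd₋ , σ-root≉-3 nd₋) ∷ []
      where
      1≉xx : ¬ + 1 ≈ x * x
      1≉xx = ∤-≡ (identity x) (∤-* p∤1-x p∤1+x)
        where
        identity : ∀ x → (+ 1 - x) * (+ 1 + x) ≡ + 1 - x * x
        identity = solve-∀
      -3≉xx : ¬ - + 3 ≈ x * x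
      -3≉xx = ∤-≡ (identity x) (∤-neg p∤x²+3)
        where
        identity : ∀ x → - (x * x + + 3) ≡ - + 3 - x * x
        identity = solve-∀

module Solutions {p : ℕ} (p-prime : Prime p) (3<p : 3 < p) (t : ℚ) (t∈Rp : InRp p t) where

  open ModPrime p-prime
  open HalfRange p-prime (ℕ.<-trans (ℕ.n<1+n 2) 3<p)
  open Orbit p-prime 3<p

  A B : ℤ
  A = ↥ t
  B = ↧ t

  p∤B : ¬ + p ∣ B
  p∤B = t∈Rp ∘ ∣⇒∣ᵤ

  SolCong⇔ : ∀ {y} → SolCong p t y ⇔ + p ∣ Φ A B (+ y * + y)
  SolCong⇔ {y} = mk⇔ (∣ᵤ⇒∣ {+ p} {Φ A B (+ y * + y)}) (∣⇒∣ᵤ {+ p} {Φ A B (+ y * + y)})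

  ≡27⇔ : t ≡ q27 [modℚ p ] ⇔ + p ∣ + 27 * B - A
  ≡27⇔ = mk⇔ (∣-multiple (- + 1) (flip A B) ∘ ∣ᵤ⇒∣ {+ p} {A * + 1 - + 27 * B})
             (∣⇒∣ᵤ {+ p} {A * + 1 - + 27 * B} ∘ ∣-multiple (- + 1) (unflip A B))
    where
    flip : ∀ A B → + 27 * B - A ≡ - + 1 * (A * + 1 - + 27 * B)
    flip = solve-∀
    unflip : ∀ A B → A * + 1 - + 27 * B ≡ - + 1 * (+ 27 * B - A)
    unflip = solve-∀

  Φ≡0⇔Δ≡0 : ∀ u → ¬ + p ∣ V u → + p ∣ Φ A B u → ∀ w → + p ∣ Φ A B w ⇔ + p ∣ Δ u w
  Φ≡0⇔Δ≡0 u p∤Vu p∣Φu w = mk⇔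
    (λ p∣Φw → ∣-cancelˡ p∤B (∣m+n∣n⇒∣m (∣-difference (∣n⇒∣m*n (V u * V u) p∣Φw)) p∣VwVwΦu))
    (λ p∣Δ → ∣-cancelˡ (∤-* p∤Vu p∤Vu)
      (subst (+ p ∣_) (sym (Φ-difference A B u w)) (∣m∣n⇒∣m+n (∣n⇒∣m*n B p∣Δ) p∣VwVwΦu)))
    where
    ∣-difference = subst (+ p ∣_) (Φ-difference A B u w)
    p∣VwVwΦu : + p ∣ V w * V w * Φ A B u
    p∣VwVwΦu = ∣n⇒∣m*n (V w * V w) p∣Φu

  Φ≡0∧t≡27⇒Ψ≡0 : ∀ w → + p ∣ Φ A B w → + p ∣ + 27 * B - A → + p ∣ Ψ w
  Φ≡0∧t≡27⇒Ψ≡0 w p∣Φw p∣27B-A = ∣-cancelˡ p∤B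
    (∣m+n∣n⇒∣m (subst (+ p ∣_) (Φ-at-27 A B w) p∣Φw) (∣n⇒∣m*n (V w * V w) p∣27B-A))

  Φ≡0∧Ψ≡0⇒t≡27 : ∀ w → ¬ + p ∣ V w → + p ∣ Φ A B w → + p ∣ Ψ w → + p ∣ + 27 * B - A
  Φ≡0∧Ψ≡0⇒t≡27 w p∤Vw p∣Φw p∣Ψ = ∣-cancelˡ (∤-* p∤Vw p∤Vw)
    (∣m+n∣m⇒∣n (subst (+ p ∣_) (Φ-at-27 A B w) p∣Φw) (∣n⇒∣m*n B p∣Ψ))

  classes-at-27 : + p ∣ + 27 * B - A →
                  ∀ w → + p ∣ Φ A B w ⇔ Any (λ z → w ≈ z * z) (+ 0 ∷ + 3 ∷ [])
  classes-at-27 p∣27B-A w = mk⇔ (classify ∘ factors) from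
    where
    w≡w-0 : w ≡ w - + 0 * + 0
    w≡w-0 = sym (ℤ.+-identityʳ w)
    factors : + p ∣ Φ A B w → + p ∣ w ⊎ w ≈ + 9 ⊎ w ≈ + 9
    factors p∣Φw = euclidsLemma₃ w (w - + 9) (w - + 9) (Φ≡0∧t≡27⇒Ψ≡0 w p∣Φw p∣27B-A)
    classify : + p ∣ w ⊎ w ≈ + 9 ⊎ w ≈ + 9 → Any (λ z → w ≈ z * z) (+ 0 ∷ + 3 ∷ [])
    classify (inj₁ p∣w)         = here (subst (+ p ∣_) w≡w-0 p∣w)
    classify (inj₂ (inj₁ w≈9)) = there (here w≈9)
    classify (inj₂ (inj₂ w≈9)) = there (here w≈9)
    Ψ≡0 : Any (λ z → w ≈ z * z) (+ 0 ∷ + 3 ∷ []) → + p ∣ Ψ w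
    Ψ≡0 (here w≈0)         = ∣m⇒∣m*n (w - + 9) (∣m⇒∣m*n (w - + 9) (subst (+ p ∣_) (sym w≡w-0) w≈0))
    Ψ≡0 (there (here w≈9)) = ∣n⇒∣m*n (w * (w - + 9)) w≈9
    from : Any (λ z → w ≈ z * z) (+ 0 ∷ + 3 ∷ []) → + p ∣ Φ A B w
    from z∈ = subst (+ p ∣_) (sym (Φ-at-27 A B w))
      (∣m∣n⇒∣m+n (∣n⇒∣m*n B (Ψ≡0 z∈)) (∣n⇒∣m*n (V w * V w) p∣27B-A))

  length-Sols≡2 : t ≡ q27 [modℚ p ] → length (Sols p t) ≡ 2
  length-Sols≡2 t≡27 = length-filter-Hp (SolCong? p t) (+ 0 ∷ + 3 ∷ [])
    ((∤-neg (∤-* p∤3 p∤3) ∷ []) ∷ [] ∷ [])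
    ((p∤1 , ∤-neg p∤3) ∷ (∤-neg (∤-* p∤2 p∤4) , ∤-neg (∤-* p∤3 p∤4)) ∷ [])
    (λ {y} _ → classes-at-27 (Equivalence.to ≡27⇔ t≡27) (+ y * + y) ⇔-∘ SolCong⇔ {y})

  p∤V : ∀ {x} → x ∈ Hp p → ¬ + p ∣ V (+ x * + x)
  p∤V {x} x∈Hp = ∤-≡ (identity (+ x)) (∤-neg (∤-* (proj₁ units) (proj₁ (proj₂ units))))
    where
    units = ∈Hp⇒units x∈Hp
    identity : ∀ x → - ((+ 1 - x) * (+ 1 + x)) ≡ x * x - + 1
    identity = solve-∀

  nonDegenerate : ∀ {x} → x ∈ Hp p → SolCong p t x → ¬ t ≡ q27 [modℚ p ] → NonDegenerate (+ x)
  nonDegenerate {x} x∈Hp sol-x t≢27 = record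
    { p∤x    = p∤Ψ ∘ ∣m⇒∣m*n (xx - + 9) ∘ ∣m⇒∣m*n (xx - + 9) ∘ ∣m⇒∣m*n (+ x)
    ; p∤1-x  = p∤1-x
    ; p∤1+x  = p∤1+x
    ; p∤x-3  = p∤Ψ ∘ ∣n⇒∣m*n (xx * (xx - + 9)) ∘ ∣-multiple (+ x + + 3) (factor (+ x))
    ; p∤x+3  = p∤Ψ ∘ ∣n⇒∣m*n (xx * (xx - + 9)) ∘ ∣-multiple (+ x - + 3) (factor′ (+ x))
    ; p∤x²+3 = proj₂ (proj₂ (∈Hp⇒units x∈Hp))
    }
    where
    xx = + x * + x
    p∤1-x = proj₁ (∈Hp⇒units x∈Hp)
    p∤1+x = proj₁ (proj₂ (∈Hp⇒units x∈Hp))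
    p∤Ψ : ¬ + p ∣ Ψ xx
    p∤Ψ = t≢27 ∘ Equivalence.from ≡27⇔
        ∘ Φ≡0∧Ψ≡0⇒t≡27 xx (p∤V x∈Hp) (Equivalence.to (SolCong⇔ {x}) sol-x)
    factor : ∀ x → x * x - + 9 ≡ (x + + 3) * (x - + 3)
    factor = solve-∀
    factor′ : ∀ x → x * x - + 9 ≡ (x - + 3) * (x + + 3)
    factor′ = solve-∀

  length-Sols≡3 : ∀ {x} → x ∈ Hp p → SolCong p t x →
                  ¬ t ≡ q27 [modℚ p ] → length (Sols p t) ≡ 3
  length-Sols≡3 {x} x∈Hp sol-x t≢27 = length-filter-Hp (SolCong? p t) (orbit nd)
    (orbit-distinct nd) (orbit-admissible nd)
    (λ {y} _ → orbit-classes nd (+ y * + y) ⇔-∘ (same-value (+ y * + y) ⇔-∘ SolCong⇔ {y}))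
    where
    nd = nonDegenerate x∈Hp sol-x t≢27
    same-value = Φ≡0⇔Δ≡0 (+ x * + x) (p∤V x∈Hp) (Equivalence.to (SolCong⇔ {x}) sol-x)

lemma2p2 : (p : ℕ) → Prime p → 3 < p → (t : ℚ) → InRp p t →
    ¬ (t ≡ 0ℚ [modℚ p ]) →
    (∃[ x ] (x ∈ Hp p × SolCong p t x)) →
    ((¬ (t ≡ q27 [modℚ p ]) → length (Sols p t) ≡ 3) ×
     (t ≡ q27 [modℚ p ] → length (Sols p t) ≡ 2))
lemma2p2 p p-prime 3<p t t∈Rp _ (x , x∈Hp , sol-x) = length-Sols≡3 x∈Hp sol-x , length-Sols≡2
  where open Solutions p-prime 3<p t t∈Rp
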